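{- For every $m\ge 1$, the sum of $\varsigma(\mathcal M_\bullet)$ over all isomorphism classes of rooted maps $\mathcal M_\bullet$ with $m$ edges equals $\dfrac{(2m)!}{m!}$, where $\varsigma(\mathcal M_\bullet)$ is the number of quasi-trees of $\mathcal M_\bullet$.
   Context: A map is a triple $\mathcal M=(B,\sigma,\alpha)$ with $B$ a finite set (of flags), $\sigma,\alpha\in\mathrm{Sym}(B)$, $\alpha$ a fixed-point-free involution, $\langle\sigma,\alpha\rangle$ transitive on $B$; permutations compose as functions. Edges are the cycles of $\alpha$ (so a map with $m$ edges has $2m$ flags); $\underline b=\{b,\alpha(b)\}$. The tour of a set $F$ of edges is $\tau$ with $\tau(b)=\sigma\alpha(b)$ if $\underline b\in F$, $\tau(b)=\sigma(b)$ otherwise; a quasi-tree is a set of edges whose tour is a single cycle on $B$. A rooted map is a pair $(\mathcal M,b_\bullet)$ with $b_\bullet\in B$; $(\mathcal M,b_\bullet)$ and $(\mathcal M',b'_\bullet)$ are isomorphic if there is a bijection $f:B\to B'$ with $\sigma'=f\sigma f^{ -1}$, $\alpha'=f\alpha f^{ -1}$ and $f(b_\bullet)=b'_\bullet$. -}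

module Defs where

open import Data.Nat using (ℕ; zero; suc; _*_)
open import Data.Fin using (Fin; toℕ; _≟_)
open import Data.Fin.Properties using (all?; any?)
open import Data.Fin.Permutation using (Permutation′; _⟨$⟩ʳ_; _⟨$⟩ˡ_)
open import Data.Fin.Subset using (Subset)
open import Data.Bool using (Bool; true; false; if_then_else_)
open import Data.Vec using (Vec; []; _∷_; lookup)
open import Data.List using (List; []; _∷_; _++_; map; filter; length; foldr)
open import Data.Product using (Σ; ∃; _×_; _,_; proj₁)
open import Function using (_∘_)
open import Relation.Binary.PropositionalEquality using (_≡_; _≢_)
open import Relation.Nullary using (Dec; yes; no)
open import Relation.Nullary.Decidable using (_×-dec_)

iter : {A : Set} → (A → A) → ℕ → A → A
iter f zero    x = x
iter f (suc k) x = f (iter f k x)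

-- generators of the monodromy group ⟨σ, α⟩ (α is an involution, so α⁻¹ = α)
data Gen : Set where
  gσ gσ⁻¹ gα : Gen

-- action of a word in the generators σ, σ⁻¹, α (applied right to left)
actWord : ∀ {n} → (σ α : Permutation′ n) → List Gen → Fin n → Fin n
actWord σ α []         b = b
actWord σ α (gσ ∷ w)   b = σ ⟨$⟩ʳ actWord σ α w b
actWord σ α (gσ⁻¹ ∷ w) b = σ ⟨$⟩ˡ actWord σ α w b
actWord σ α (gα ∷ w)   b = α ⟨$⟩ʳ actWord σ α w b

-- A map whose flag set is Fin n.  Permutations compose as functions.
-- Transitivity of ⟨σ, α⟩: every flag c is reached from every flag b by a word.
record Map (n : ℕ) : Set where
  field
    σ α : Permutation′ n
    α-invol    : ∀ b → α ⟨$⟩ʳ (α ⟨$⟩ʳ b) ≡ b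
    α-fpf      : ∀ b → α ⟨$⟩ʳ b ≢ b
    transitive : ∀ b c → ∃ λ (w : List Gen) → actWord σ α w b ≡ c

open Map public

RootedMap : ℕ → Set
RootedMap n = Map n × Fin n

Iso : ∀ {n} → RootedMap n → RootedMap n → Set
Iso {n} (M , r) (M' , r') = Σ (Permutation′ n) λ f →
    (∀ b → σ M' ⟨$⟩ʳ (f ⟨$⟩ʳ b) ≡ f ⟨$⟩ʳ (σ M ⟨$⟩ʳ b))
  × (∀ b → α M' ⟨$⟩ʳ (f ⟨$⟩ʳ b) ≡ f ⟨$⟩ʳ (α M ⟨$⟩ʳ b))
  × (f ⟨$⟩ʳ r ≡ r')

-- A set F of edges is encoded as the set of flags S = ⋃ F, i.e. a subset
-- of flags closed under α (b ∈ S iff α b ∈ S); this is a bijective encoding.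
all-subsets : (n : ℕ) → List (Subset n)
all-subsets zero    = [] ∷ []
all-subsets (suc n) = map (true ∷_) (all-subsets n) ++ map (false ∷_) (all-subsets n)

EdgeClosed : ∀ {n} → Map n → Subset n → Set
EdgeClosed M S = ∀ b → lookup S b ≡ lookup S (α M ⟨$⟩ʳ b)

tour : ∀ {n} → Map n → Subset n → Fin n → Fin n
tour M S b = if lookup S b then σ M ⟨$⟩ʳ (α M ⟨$⟩ʳ b) else σ M ⟨$⟩ʳ b

-- a permutation τ of Fin n is a single cycle: every c lies on the cycle of every b
-- (the cycle of b under a permutation of an n-set is {τ^k b | k < n})
SingleCycle : ∀ {n} → (Fin n → Fin n) → Set
SingleCycle {n} τ = ∀ b c → ∃ λ (k : Fin n) → iter τ (toℕ k) b ≡ c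

IsQuasiTree : ∀ {n} → Map n → Subset n → Set
IsQuasiTree M S = EdgeClosed M S × SingleCycle (tour M S)

isQuasiTree? : ∀ {n} (M : Map n) (S : Subset n) → Dec (IsQuasiTree M S)
isQuasiTree? M S =
  all? (λ b → Data.Bool._≟_ (lookup S b) (lookup S (α M ⟨$⟩ʳ b)))
  ×-dec all? (λ b → all? (λ c → any? (λ k → iter (tour M S) (toℕ k) b ≟ c)))
  where import Data.Bool

ς : ∀ {n} → Map n → ℕ
ς M = length (filter (isQuasiTree? M) (all-subsets _))

IsRepSystem : ∀ {n} → List (RootedMap n) → Set
IsRepSystem {n} L =
    (∀ (M : RootedMap n) → ∃ λ (i : Fin (length L)) → Iso M (Data.List.lookup L i))
  × (∀ (i j : Fin (length L)) → Iso (Data.List.lookup L i) (Data.List.lookup L j) → i ≡ j)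
  where import Data.List

{-# OPTIONS --safe #-}
-- Number the flags 0, 1, … along the tour of a quasi-tree F, starting at the root. In this
-- numbering the tour is the cyclic shift, so σ = shift ∘ α_F, where α_F acts as α on the
-- flags of F and as the identity elsewhere; hence the rooted map is recovered from the
-- fixed-point-free involution α together with the α-closed set F. Conversely σ = shift ∘ α_F
-- turns any such pair into a rooted map in which F is a quasi-tree with the shift as its tour.
-- So summing ς over the isomorphism classes counts these pairs. Conjugating the partner of
-- flag 0 to flag 1 and deleting that edge gives c(n+2) = (n+1)·2·c(n) for their number,
-- whence c(2m) = (2m-1)!!·2^m = (2m)!/m!.
module Submission where

open import Defs
open import Level using (0ℓ)
open import Data.Nat using (ℕ; zero; suc; _+_; _*_; _∸_; _≤_; _<_; _≥_; _/_; _!; s≤s; _<?_; _≤?_)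
open import Data.Nat.Properties
  using (_!≢0; <⇒≢; <⇒≤; ≰⇒>; ≤-pred; ≤-refl; ≤-trans; ≤-<-trans; ≤-reflexive; n≤1+n; m∸n≤m; m∸n+n≡m
        ; m+[n∸m]≡n; +-monoˡ-<; <-irrefl; m≤n⇒m<n∨m≡n; ≤∧≮⇒≡; *-suc)
open import Data.Nat.Tactic.RingSolver using (solve-∀)
open import Data.Nat.DivMod using (m*n/n≡m)
open import Data.Fin using (Fin; zero; suc; toℕ; fromℕ; fromℕ<; inject₁; punchOut; _≟_)
open import Data.Fin.Properties
  using (+↔⊎; *↔×; 2↔Bool; suc-injective; toℕ-injective; toℕ-fromℕ<; toℕ-fromℕ; toℕ<n; toℕ-inject₁
        ; fromℕ≢inject₁; any?; injective⇒≤; punchOut-injective)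
open import Data.Fin.Permutation as P
  using (Permutation′; permutation; _⟨$⟩ʳ_; _⟨$⟩ˡ_; inverseˡ; inverseʳ; flip; _∘ₚ_; transpose; ↔⇒≡)
  renaming (_≈_ to _≈ₚ_)
open import Data.Fin.Subset using (Subset)
open import Data.Bool using (Bool; true; false; if_then_else_)
open import Data.Vec using ([]; _∷_; lookup; tabulate)
open import Data.List as List using (List; []; _∷_; _++_; map; filter; length)
open import Data.List.Properties using (length-++; filter-++)
open import Data.Vec.Properties using (lookup∘tabulate; tabulate-cong; tabulate∘lookup)
open import Data.Nat.ListAction using (sum)
open import Data.Product using (Σ; ∃; _×_; _,_; proj₁; proj₂)
open import Data.Product.Relation.Binary.Pointwise.NonDependent as ×ₚ using (_×ₛ_)
open import Data.Product.Function.NonDependent.Setoid using (_×-inverse_)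
open import Data.Sum using (_⊎_; inj₁; inj₂)
open import Data.Sum.Relation.Binary.Pointwise as ⊎ₚ using (_⊎ₛ_; inj₁; inj₂)
open import Data.Sum.Function.Setoid using (_⊎-inverse_)
open import Function using (_∘_; case_of_)
open import Function.Bundles using (Inverse)
open import Function.Definitions using (Injective; Congruent; StrictlyInverseˡ; StrictlyInverseʳ)
open import Function.Consequences.Setoid using (strictlyInverseˡ⇒inverseˡ; strictlyInverseʳ⇒inverseʳ)
import Function.Construct.Composition as Comp
import Function.Construct.Symmetry as Sym
import Function.Construct.Identity as Id
open import Relation.Binary.Bundles using (Setoid)
import Relation.Binary.Construct.On as On
open import Relation.Binary.PropositionalEquality as ≡ using (_≡_; _≢_; _≗_; refl; cong; cong₂; sym; trans)
open import Relation.Nullary using (yes; no; does; contradiction)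
open import Relation.Unary using (Pred; Decidable)
open import Data.Empty using (⊥; ⊥-elim)

module _ {A B : Setoid 0ℓ 0ℓ} where
  open Setoid A renaming (Carrier to ∣A∣; _≈_ to _≈₁_)
  open Setoid B renaming (Carrier to ∣B∣; _≈_ to _≈₂_)

  mkInverse : (to : ∣A∣ → ∣B∣) (from : ∣B∣ → ∣A∣) →
              Congruent _≈₁_ _≈₂_ to → Congruent _≈₂_ _≈₁_ from →
              StrictlyInverseˡ _≈₂_ to from → StrictlyInverseʳ _≈₁_ to from →
              Inverse A B
  mkInverse to from to-cong from-cong invˡ invʳ = record
    { to = to ; from = from ; to-cong = to-cong ; from-cong = from-cong
    ; inverse = strictlyInverseˡ⇒inverseˡ A B to-cong invˡ
              , strictlyInverseʳ⇒inverseʳ A B from-cong invʳ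
    }

HasSize : Setoid 0ℓ 0ℓ → ℕ → Set
HasSize A k = Inverse A (≡.setoid (Fin k))

size-unique : ∀ {A : Setoid 0ℓ 0ℓ} {k l} → HasSize A k → HasSize A l → k ≡ l
size-unique I J = ↔⇒≡ (Comp.inverse (Sym.inverse I) J)

module _ {A B : Setoid 0ℓ 0ℓ} {k l : ℕ} where

  size-⊎ : HasSize A k → HasSize B l → HasSize (A ⊎ₛ B) (k + l)
  size-⊎ I J = Comp.inverse (I ⊎-inverse J) (Comp.inverse (⊎ₚ.Pointwise-≡↔≡ _ _) (Sym.inverse +↔⊎))

  size-× : HasSize A k → HasSize B l → HasSize (A ×ₛ B) (k * l)
  size-× I J = Comp.inverse (I ×-inverse J) (Comp.inverse ×ₚ.Pointwise-≡↔≡ (Sym.inverse *↔×))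

size-resp-Inverse : {A B : Setoid 0ℓ 0ℓ} {k : ℕ} → Inverse A B → HasSize B k → HasSize A k
size-resp-Inverse = Comp.inverse

Sub : {A : Set} → Pred A 0ℓ → Setoid 0ℓ 0ℓ
Sub {A} P = On.setoid {B = Σ A P} (≡.setoid A) proj₁

module _ {n : ℕ} (P : Pred (Subset (suc n)) 0ℓ) where

  Sub-Subset-suc : Inverse (Sub P) (Sub (P ∘ (true ∷_)) ⊎ₛ Sub (P ∘ (false ∷_)))
  Sub-Subset-suc = mkInverse to from to-cong from-cong invˡ invʳ
    where
    to : Σ (Subset (suc n)) P → Σ (Subset n) (P ∘ (true ∷_)) ⊎ Σ (Subset n) (P ∘ (false ∷_))
    to (true  ∷ S , p) = inj₁ (S , p)
    to (false ∷ S , p) = inj₂ (S , p)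
    from : Σ (Subset n) (P ∘ (true ∷_)) ⊎ Σ (Subset n) (P ∘ (false ∷_)) → Σ (Subset (suc n)) P
    from (inj₁ (S , p)) = true  ∷ S , p
    from (inj₂ (S , p)) = false ∷ S , p
    to-cong : ∀ {x y} → proj₁ x ≡ proj₁ y → ⊎ₚ.Pointwise _ _ (to x) (to y)
    to-cong {true  ∷ _ , _} {true  ∷ _ , _} refl = inj₁ refl
    to-cong {false ∷ _ , _} {false ∷ _ , _} refl = inj₂ refl
    from-cong : ∀ {x y} → ⊎ₚ.Pointwise _ _ x y → proj₁ (from x) ≡ proj₁ (from y)
    from-cong (inj₁ refl) = refl
    from-cong (inj₂ refl) = refl
    invˡ : ∀ y → ⊎ₚ.Pointwise _ _ (to (from y)) y
    invˡ (inj₁ _) = inj₁ refl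
    invˡ (inj₂ _) = inj₂ refl
    invʳ : ∀ x → proj₁ (from (to x)) ≡ proj₁ x
    invʳ (true  ∷ _ , _) = refl
    invʳ (false ∷ _ , _) = refl

module _ {A : Set} {k : ℕ} (P : Pred (Fin (suc k) × A) 0ℓ) where

  private
    P₀ : Pred A 0ℓ
    P₀ a = P (zero , a)
    P₊ : Pred (Fin k × A) 0ℓ
    P₊ (i , a) = P (suc i , a)

  Sub-Fin-suc : Inverse (Sub P) (Sub P₀ ⊎ₛ Sub P₊)
  Sub-Fin-suc = mkInverse to from to-cong from-cong invˡ invʳ
    where
    to : Σ _ P → Σ A P₀ ⊎ Σ _ P₊
    to ((zero  , a) , p) = inj₁ (a , p)
    to ((suc i , a) , p) = inj₂ ((i , a) , p)
    from : Σ A P₀ ⊎ Σ _ P₊ → Σ _ P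
    from (inj₁ (a , p))       = (zero , a) , p
    from (inj₂ ((i , a) , p)) = (suc i , a) , p
    to-cong : ∀ {x y} → proj₁ x ≡ proj₁ y → ⊎ₚ.Pointwise _ _ (to x) (to y)
    to-cong {(zero  , _) , _} refl = inj₁ refl
    to-cong {(suc _ , _) , _} refl = inj₂ refl
    from-cong : ∀ {x y} → ⊎ₚ.Pointwise _ _ x y → proj₁ (from x) ≡ proj₁ (from y)
    from-cong (inj₁ refl) = refl
    from-cong (inj₂ refl) = refl
    invˡ : ∀ y → ⊎ₚ.Pointwise _ _ (to (from y)) y
    invˡ (inj₁ _) = inj₁ refl
    invˡ (inj₂ _) = inj₂ refl
    invʳ : ∀ x → proj₁ (from (to x)) ≡ proj₁ x
    invʳ ((zero  , _) , _) = refl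
    invʳ ((suc _ , _) , _) = refl

length-filter-map : {A B : Set} {P : Pred A 0ℓ} (P? : Decidable P) (g : B → A) (xs : List B) →
                    length (filter P? (map g xs)) ≡ length (filter (P? ∘ g) xs)
length-filter-map P? g []       = refl
length-filter-map P? g (x ∷ xs) with does (P? (g x))
... | true  = cong suc (length-filter-map P? g xs)
... | false = length-filter-map P? g xs

size-filter-all-subsets : ∀ n {P : Pred (Subset n) 0ℓ} (P? : Decidable P) →
                          HasSize (Sub P) (length (filter P? (all-subsets n)))
size-filter-all-subsets zero {P} P? with P? []
... | yes p = mkInverse (λ _ → zero) (λ _ → [] , p) (λ _ → refl) (λ _ → refl)
                        (λ { zero → refl }) (λ { ([] , _) → refl })
... | no ¬p = mkInverse (λ { ([] , p) → ⊥-elim (¬p p) }) (λ ()) (λ { {[] , p} → ⊥-elim (¬p p) })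
                        (λ { {()} }) (λ ()) (λ { ([] , p) → ⊥-elim (¬p p) })
size-filter-all-subsets (suc n) {P} P? =
  ≡.subst (HasSize (Sub P)) (sym count-split)
    (size-resp-Inverse (Sub-Subset-suc P)
      (size-⊎ (size-filter-all-subsets n (P? ∘ (true ∷_))) (size-filter-all-subsets n (P? ∘ (false ∷_)))))
  where
  xs = all-subsets n
  count-split : length (filter P? (all-subsets (suc n)))
              ≡ length (filter (P? ∘ (true ∷_)) xs) + length (filter (P? ∘ (false ∷_)) xs)
  count-split = begin
    length (filter P? (map (true ∷_) xs ++ map (false ∷_) xs))
      ≡⟨ cong length (filter-++ P? (map (true ∷_) xs) _) ⟩
    length (filter P? (map (true ∷_) xs) ++ filter P? (map (false ∷_) xs))
      ≡⟨ length-++ (filter P? (map (true ∷_) xs)) ⟩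
    length (filter P? (map (true ∷_) xs)) + length (filter P? (map (false ∷_) xs))
      ≡⟨ cong₂ _+_ (length-filter-map P? (true ∷_) xs) (length-filter-map P? (false ∷_) xs) ⟩
    length (filter (P? ∘ (true ∷_)) xs) + length (filter (P? ∘ (false ∷_)) xs) ∎
    where open ≡.≡-Reasoning

size-sum : {X A : Set} (Q : X → Pred A 0ℓ) (f : X → ℕ) → (∀ x → HasSize (Sub (Q x)) (f x)) → (L : List X) →
           HasSize (Sub {Fin (length L) × A} (λ (i , a) → Q (List.lookup L i) a)) (sum (map f L))
size-sum Q f size-Q [] =
  mkInverse (λ { ((() , _) , _) }) (λ ()) (λ { {(() , _) , _} }) (λ { {()} }) (λ ()) (λ { ((() , _) , _) })
size-sum Q f size-Q (x ∷ L) =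
  size-resp-Inverse (Sub-Fin-suc _) (size-⊎ (size-Q x) (size-sum Q f size-Q L))

inverse-cong : ∀ {n} (π ρ : Permutation′ n) → π ≈ₚ ρ → ∀ i → π ⟨$⟩ˡ i ≡ ρ ⟨$⟩ˡ i
inverse-cong π ρ π≈ρ i = begin
  π ⟨$⟩ˡ i                   ≡⟨ cong (π ⟨$⟩ˡ_) (sym (inverseʳ ρ)) ⟩
  π ⟨$⟩ˡ (ρ ⟨$⟩ʳ (ρ ⟨$⟩ˡ i)) ≡⟨ cong (π ⟨$⟩ˡ_) (sym (π≈ρ (ρ ⟨$⟩ˡ i))) ⟩
  π ⟨$⟩ˡ (π ⟨$⟩ʳ (ρ ⟨$⟩ˡ i)) ≡⟨ inverseˡ π ⟩
  ρ ⟨$⟩ˡ i                   ∎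
  where open ≡.≡-Reasoning

record MarkedMatching (n : ℕ) : Set where
  field
    partner            : Fin n → Fin n
    marked             : Fin n → Bool
    partner-involutive : ∀ b → partner (partner b) ≡ b
    partner-fpf        : ∀ b → partner b ≢ b
    marked-closed      : ∀ b → marked b ≡ marked (partner b)

open MarkedMatching

module _ {n : ℕ} where

  record _≈ₘ_ (I J : MarkedMatching n) : Set where
    constructor mk≈ₘ
    field
      partner-≗ : partner I ≗ partner J
      marked-≗  : marked I ≗ marked J

  ≈ₘ-refl : ∀ {I} → I ≈ₘ I
  ≈ₘ-refl = mk≈ₘ (λ _ → refl) (λ _ → refl)

  ≈ₘ-trans : ∀ {I J K} → I ≈ₘ J → J ≈ₘ K → I ≈ₘ K
  ≈ₘ-trans (mk≈ₘ p m) (mk≈ₘ p′ m′) = mk≈ₘ (λ b → trans (p b) (p′ b)) (λ b → trans (m b) (m′ b))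

  partner-injective : (I : MarkedMatching n) → ∀ {a b} → partner I a ≡ partner I b → a ≡ b
  partner-injective I {a} {b} eq =
    trans (sym (partner-involutive I a)) (trans (cong (partner I) eq) (partner-involutive I b))

MarkedMatchingₛ : ℕ → Setoid 0ℓ 0ℓ
MarkedMatchingₛ n = record
  { Carrier = MarkedMatching n
  ; _≈_ = _≈ₘ_
  ; isEquivalence = record
    { refl = λ {I} → ≈ₘ-refl {I = I}
    ; sym = λ (mk≈ₘ p m) → mk≈ₘ (λ b → sym (p b)) (λ b → sym (m b))
    ; trans = λ {I} {J} {K} → ≈ₘ-trans {I = I} {J} {K}
    }
  }

conjugate : ∀ {n} → Permutation′ n → MarkedMatching n → MarkedMatching n
conjugate π I = record
  { partner            = λ b → π ⟨$⟩ʳ partner I (π ⟨$⟩ˡ b)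
  ; marked             = λ b → marked I (π ⟨$⟩ˡ b)
  ; partner-involutive = λ b → trans (cong (λ c → π ⟨$⟩ʳ partner I c) (inverseˡ π))
                                 (trans (cong (π ⟨$⟩ʳ_) (partner-involutive I _)) (inverseʳ π))
  ; partner-fpf        = λ b eq → partner-fpf I (π ⟨$⟩ˡ b)
                                    (trans (sym (inverseˡ π)) (cong (π ⟨$⟩ˡ_) eq))
  ; marked-closed      = λ b → trans (marked-closed I _) (cong (marked I) (sym (inverseˡ π)))
  }

module _ {n} (π : Permutation′ n) (I : MarkedMatching n) where

  conjugate-inverseˡ : conjugate (flip π) (conjugate π I) ≈ₘ I
  conjugate-inverseˡ = mk≈ₘ (λ b → trans (cong (λ c → π ⟨$⟩ˡ (π ⟨$⟩ʳ partner I c)) (inverseˡ π)) (inverseˡ π))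
                            (λ b → cong (marked I) (inverseˡ π))

  conjugate-inverseʳ : conjugate π (conjugate (flip π) I) ≈ₘ I
  conjugate-inverseʳ = mk≈ₘ (λ b → trans (cong (λ c → π ⟨$⟩ʳ (π ⟨$⟩ˡ partner I c)) (inverseʳ π)) (inverseʳ π))
                            (λ b → cong (marked I) (inverseʳ π))

conjugate-cong : ∀ {n} (π ρ : Permutation′ n) {I J : MarkedMatching n} →
                 π ≈ₚ ρ → I ≈ₘ J → conjugate π I ≈ₘ conjugate ρ J
conjugate-cong π ρ {I} {J} π≈ρ (mk≈ₘ p m) = mk≈ₘ
    (λ b → trans (π≈ρ _) (cong (ρ ⟨$⟩ʳ_) (trans (p _) (cong (partner J) (inverse-cong π ρ π≈ρ b)))))
    (λ b → trans (m _) (cong (marked J) (inverse-cong π ρ π≈ρ b)))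

module _ {n : ℕ} where

  extend : Bool → MarkedMatching n → MarkedMatching (suc (suc n))
  extend b J = record
    { partner            = partner′
    ; marked             = marked′
    ; partner-involutive = λ { zero → refl ; (suc zero) → refl ; (suc (suc k)) → cong (λ j → suc (suc j)) (partner-involutive J k) }
    ; partner-fpf        = λ { zero () ; (suc zero) () ; (suc (suc k)) eq → partner-fpf J k (suc-injective (suc-injective eq)) }
    ; marked-closed      = λ { zero → refl ; (suc zero) → refl ; (suc (suc k)) → marked-closed J k }
    }
    where
    partner′ : Fin (suc (suc n)) → Fin (suc (suc n))
    partner′ zero          = suc zero
    partner′ (suc zero)    = zero
    partner′ (suc (suc k)) = suc (suc (partner J k))
    marked′ : Fin (suc (suc n)) → Bool
    marked′ zero          = b
    marked′ (suc zero)    = b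
    marked′ (suc (suc k)) = marked J k

  extend-cong : ∀ b {J J′} → J ≈ₘ J′ → extend b J ≈ₘ extend b J′
  extend-cong b (mk≈ₘ p m) = mk≈ₘ (λ { zero → refl ; (suc zero) → refl ; (suc (suc k)) → cong (λ j → suc (suc j)) (p k) })
                                 (λ { zero → refl ; (suc zero) → refl ; (suc (suc k)) → m k })

  module _ (I : MarkedMatching (suc (suc n))) (pinned : partner I zero ≡ suc zero) where

    partner-suc-suc : ∀ k → Σ (Fin n) λ j → partner I (suc (suc k)) ≡ suc (suc j)
    partner-suc-suc k with partner I (suc (suc k)) in eq
    ... | zero        = case trans (sym (partner-involutive I _)) (trans (cong (partner I) eq) pinned) of λ ()
    ... | suc zero    = case partner-injective I (trans eq (sym pinned)) of λ ()
    ... | suc (suc j) = j , refl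

    restrict : MarkedMatching n
    restrict = record
      { partner            = partner′
      ; marked             = λ k → marked I (suc (suc k))
      ; partner-involutive = λ k → suc-injective (suc-injective (begin
          suc (suc (partner′ (partner′ k))) ≡⟨ sym (spec (partner′ k)) ⟩
          partner I (suc (suc (partner′ k))) ≡⟨ cong (partner I) (sym (spec k)) ⟩
          partner I (partner I (suc (suc k))) ≡⟨ partner-involutive I _ ⟩
          suc (suc k) ∎))
      ; partner-fpf        = λ k eq → partner-fpf I _ (trans (spec k) (cong (λ j → suc (suc j)) eq))
      ; marked-closed      = λ k → trans (marked-closed I _) (cong (marked I) (spec k))
      }
      where
      open ≡.≡-Reasoning
      partner′ : Fin n → Fin n
      partner′ k = proj₁ (partner-suc-suc k)
      spec : ∀ k → partner I (suc (suc k)) ≡ suc (suc (partner′ k))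
      spec k = proj₂ (partner-suc-suc k)

    extend-restrict : extend (marked I zero) restrict ≈ₘ I
    extend-restrict = mk≈ₘ
        (λ { zero          → sym pinned
           ; (suc zero)    → trans (sym (partner-involutive I zero)) (cong (partner I) pinned)
           ; (suc (suc k)) → sym (proj₂ (partner-suc-suc k)) })
        (λ { zero          → refl
           ; (suc zero)    → trans (marked-closed I zero) (cong (marked I) pinned)
           ; (suc (suc k)) → refl })

  restrict-cong : ∀ {I I′} → I ≈ₘ I′ → ∀ pinned pinned′ → restrict I pinned ≈ₘ restrict I′ pinned′
  restrict-cong {I} {I′} (mk≈ₘ p m) pinned pinned′ = mk≈ₘ
      (λ k → suc-injective (suc-injective (trans (sym (proj₂ (partner-suc-suc I pinned k)))
                                                 (trans (p _) (proj₂ (partner-suc-suc I′ pinned′ k))))))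
      (λ k → m _)

  restrict-extend : ∀ b J → restrict (extend b J) refl ≈ₘ J
  restrict-extend b J = mk≈ₘ (λ _ → refl) (λ _ → refl)

module _ {n : ℕ} where

  exchangeOne : Fin (suc n) → Permutation′ (suc (suc n))
  exchangeOne p = transpose (suc zero) (suc p)

  exchangeOne⁻¹-one : ∀ p → exchangeOne p ⟨$⟩ˡ suc zero ≡ suc p
  exchangeOne⁻¹-one zero    = refl
  exchangeOne⁻¹-one (suc p) = refl

  exchangeOne-suc : ∀ p → exchangeOne p ⟨$⟩ʳ suc p ≡ suc zero
  exchangeOne-suc p = trans (cong (exchangeOne p ⟨$⟩ʳ_) (sym (exchangeOne⁻¹-one p))) (inverseʳ (exchangeOne p))

  exchangeOne-cong : ∀ {p q} → p ≡ q → exchangeOne p ≈ₚ exchangeOne q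
  exchangeOne-cong refl _ = refl

partner-zero : ∀ {n} (I : MarkedMatching (suc n)) → Σ (Fin n) λ p → partner I zero ≡ suc p
partner-zero I with partner I zero in eq
... | zero  = ⊥-elim (partner-fpf I zero eq)
... | suc p = p , refl

module _ {n : ℕ} where

  pinning : MarkedMatching (suc (suc n)) → Permutation′ (suc (suc n))
  pinning I = exchangeOne (proj₁ (partner-zero I))

  pinning-pinned : ∀ I → partner (conjugate (pinning I) I) zero ≡ suc zero
  pinning-pinned I = trans (cong (pinning I ⟨$⟩ʳ_) (proj₂ (partner-zero I))) (exchangeOne-suc (proj₁ (partner-zero I)))

  split : MarkedMatching (suc (suc n)) → Fin (suc n) × Bool × MarkedMatching n
  split I = proj₁ (partner-zero I) , marked I zero , restrict (conjugate (pinning I) I) (pinning-pinned I)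

  unsplit : Fin (suc n) × Bool × MarkedMatching n → MarkedMatching (suc (suc n))
  unsplit (p , b , J) = conjugate (flip (exchangeOne p)) (extend b J)

  partner-zero-unsplit : ∀ p b J → proj₁ (partner-zero (unsplit (p , b , J))) ≡ p
  partner-zero-unsplit p b J =
    suc-injective (trans (sym (proj₂ (partner-zero (unsplit (p , b , J))))) (exchangeOne⁻¹-one p))

  pinning-unsplit : ∀ p b J → conjugate (pinning (unsplit (p , b , J))) (unsplit (p , b , J)) ≈ₘ extend b J
  pinning-unsplit p b J =
    ≈ₘ-trans (conjugate-cong (pinning (unsplit (p , b , J))) (exchangeOne p)
                             (exchangeOne-cong (partner-zero-unsplit p b J)) (≈ₘ-refl {I = unsplit (p , b , J)}))
             (conjugate-inverseʳ (exchangeOne p) (extend b J))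

  split-inverse : Inverse (MarkedMatchingₛ (suc (suc n)))
                          (≡.setoid (Fin (suc n)) ×ₛ (≡.setoid Bool ×ₛ MarkedMatchingₛ n))
  split-inverse = mkInverse split unsplit split-cong unsplit-cong split-unsplit unsplit-split
    where
    open Setoid (≡.setoid (Fin (suc n)) ×ₛ (≡.setoid Bool ×ₛ MarkedMatchingₛ n)) using (_≈_)
    partner-zero-cong : ∀ {I I′} → I ≈ₘ I′ → proj₁ (partner-zero I) ≡ proj₁ (partner-zero I′)
    partner-zero-cong {I} {I′} (mk≈ₘ p _) =
      suc-injective (trans (sym (proj₂ (partner-zero I))) (trans (p zero) (proj₂ (partner-zero I′))))
    split-cong : ∀ {I I′} → I ≈ₘ I′ → split I ≈ split I′
    split-cong {I} {I′} I≈I′@(mk≈ₘ _ m) = partner-zero-cong I≈I′ , m zero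
      , restrict-cong (conjugate-cong (pinning I) (pinning I′) (exchangeOne-cong (partner-zero-cong I≈I′)) I≈I′) _ _
    unsplit-cong : ∀ {x y} → x ≈ y → unsplit x ≈ₘ unsplit y
    unsplit-cong {p , b , _} (refl , refl , J≈J′) =
      conjugate-cong (flip (exchangeOne p)) (flip (exchangeOne p)) (λ _ → refl) (extend-cong b J≈J′)
    split-unsplit : ∀ x → split (unsplit x) ≈ x
    split-unsplit (p , b , J) = partner-zero-unsplit p b J , refl
      , ≈ₘ-trans (restrict-cong (pinning-unsplit p b J) (pinning-pinned (unsplit (p , b , J))) refl)
                 (restrict-extend b J)
    unsplit-split : ∀ I → unsplit (split I) ≈ₘ I
    unsplit-split I =
      ≈ₘ-trans (conjugate-cong (flip (pinning I)) (flip (pinning I)) (λ _ → refl)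
                               (extend-restrict (conjugate (pinning I) I) (pinning-pinned I)))
               (conjugate-inverseˡ (pinning I) I)

markedMatchings : ℕ → ℕ
markedMatchings zero             = 1
markedMatchings (suc zero)       = 0
markedMatchings (suc (suc n))    = suc n * (2 * markedMatchings n)

size-MarkedMatching : ∀ n → HasSize (MarkedMatchingₛ n) (markedMatchings n)
size-MarkedMatching zero = mkInverse (λ _ → zero) (λ _ → empty) (λ _ → refl) (λ _ → ≈ₘ-refl {I = empty})
                                     (λ { zero → refl }) (λ _ → mk≈ₘ (λ ()) (λ ()))
  where
  empty : MarkedMatching 0
  empty = record { partner = λ () ; marked = λ () ; partner-involutive = λ ()
                 ; partner-fpf = λ () ; marked-closed = λ () }
size-MarkedMatching (suc zero) =
  mkInverse (λ I → ⊥-elim (no-matching I)) (λ ()) (λ {I} → ⊥-elim (no-matching I)) (λ { {()} })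
            (λ ()) (λ I → ⊥-elim (no-matching I))
  where
  no-matching : MarkedMatching 1 → ⊥
  no-matching I with partner I zero in eq
  ... | zero = partner-fpf I zero eq
size-MarkedMatching (suc (suc n)) =
  size-resp-Inverse split-inverse
    (size-× (Id.inverse _) (size-× (Sym.inverse 2↔Bool) (size-MarkedMatching n)))

module _ {A : Set} where

  iter-+ : ∀ (f : A → A) m n x → iter f (m + n) x ≡ iter f m (iter f n x)
  iter-+ f zero    n x = refl
  iter-+ f (suc m) n x = cong f (iter-+ f m n x)

  iter-cong : ∀ {f g : A → A} → f ≗ g → ∀ k → iter f k ≗ iter g k
  iter-cong         f≗g zero    x = refl
  iter-cong {g = g} f≗g (suc k) x = trans (f≗g _) (cong g (iter-cong f≗g k x))

  iter-conj : ∀ {B : Set} {f : A → A} {g : B → B} (h : A → B) → (∀ x → g (h x) ≡ h (f x)) →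
              ∀ k x → iter g k (h x) ≡ h (iter f k x)
  iter-conj         h comm zero    x = refl
  iter-conj {g = g} h comm (suc k) x = trans (cong g (iter-conj h comm k x)) (comm _)

shift : ∀ {n} → Fin (suc n) → Fin (suc n)
shift {n} k with toℕ k <? n
... | yes k<n = fromℕ< (s≤s k<n)
... | no  _   = zero

module _ {n : ℕ} where

  toℕ-shift : ∀ (k : Fin (suc n)) → toℕ k < n → toℕ (shift k) ≡ suc (toℕ k)
  toℕ-shift k k<n with toℕ k <? n
  ... | yes k<n′ = toℕ-fromℕ< (s≤s k<n′)
  ... | no  k≮n  = contradiction k<n k≮n

  shift-last : ∀ (k : Fin (suc n)) → toℕ k ≡ n → shift k ≡ zero
  shift-last k k≡n with toℕ k <? n
  ... | yes k<n = contradiction k≡n (<⇒≢ k<n)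
  ... | no  _   = refl

  toℕ-iter-shift : ∀ j → j ≤ n → toℕ (iter shift j (zero {n})) ≡ j
  toℕ-iter-shift zero    _     = refl
  toℕ-iter-shift (suc j) 1+j≤n = trans (toℕ-shift _ (≤-trans (s≤s (≤-reflexive ih)) 1+j≤n)) (cong suc ih)
    where ih = toℕ-iter-shift j (≤-trans (n≤1+n j) 1+j≤n)

  iter-shift-zero : ∀ (k : Fin (suc n)) → iter shift (toℕ k) zero ≡ k
  iter-shift-zero k = toℕ-injective (toℕ-iter-shift (toℕ k) (≤-pred (toℕ<n k)))

  iter-shift-period : iter shift (suc n) zero ≡ zero
  iter-shift-period = shift-last _ (toℕ-iter-shift n ≤-refl)

  unshift : Fin (suc n) → Fin (suc n)
  unshift zero    = fromℕ n
  unshift (suc k) = inject₁ k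

  unshift-shift : ∀ k → unshift (shift k) ≡ k
  unshift-shift k with toℕ k <? n
  ... | yes k<n = toℕ-injective (trans (toℕ-inject₁ _) (toℕ-fromℕ< k<n))
  ... | no  k≮n = toℕ-injective (trans (toℕ-fromℕ n) (sym (≤∧≮⇒≡ (≤-pred (toℕ<n k)) k≮n)))

  shift-unshift : ∀ k → shift (unshift k) ≡ k
  shift-unshift zero    = shift-last (fromℕ n) (toℕ-fromℕ n)
  shift-unshift (suc k) = toℕ-injective (trans (toℕ-shift (inject₁ k) inject₁k<n) (cong suc (toℕ-inject₁ k)))
    where
    inject₁k<n : toℕ (inject₁ k) < n
    inject₁k<n = ≡.subst (_< n) (sym (toℕ-inject₁ k)) (toℕ<n k)

singleCycle-from-root : ∀ {n} (f : Fin (suc n) → Fin (suc n)) (r : Fin (suc n)) →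
                        iter f (suc n) r ≡ r → (∀ c → ∃ λ (k : Fin (suc n)) → iter f (toℕ k) r ≡ c) →
                        SingleCycle f
singleCycle-from-root {n} f r period reach b c with reach b | reach c
... | i , refl | j , refl with toℕ i ≤? toℕ j
...   | yes i≤j = fromℕ< j∸i<N , (begin
  iter f (toℕ (fromℕ< j∸i<N)) (iter f (toℕ i) r)
    ≡⟨ cong (λ m → iter f m (iter f (toℕ i) r)) (toℕ-fromℕ< j∸i<N) ⟩
  iter f (toℕ j ∸ toℕ i) (iter f (toℕ i) r)
    ≡⟨ sym (iter-+ f (toℕ j ∸ toℕ i) (toℕ i) r) ⟩
  iter f (toℕ j ∸ toℕ i + toℕ i) r
    ≡⟨ cong (λ m → iter f m r) (m∸n+n≡m i≤j) ⟩
  iter f (toℕ j) r ∎)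
  where
  open ≡.≡-Reasoning
  j∸i<N : toℕ j ∸ toℕ i < suc n
  j∸i<N = ≤-<-trans (m∸n≤m (toℕ j) (toℕ i)) (toℕ<n j)
...   | no i≰j = fromℕ< j+[N∸i]<N , (begin
  iter f (toℕ (fromℕ< j+[N∸i]<N)) (iter f (toℕ i) r)
    ≡⟨ cong (λ m → iter f m (iter f (toℕ i) r)) (toℕ-fromℕ< j+[N∸i]<N) ⟩
  iter f (toℕ j + (suc n ∸ toℕ i)) (iter f (toℕ i) r)
    ≡⟨ iter-+ f (toℕ j) (suc n ∸ toℕ i) _ ⟩
  iter f (toℕ j) (iter f (suc n ∸ toℕ i) (iter f (toℕ i) r))
    ≡⟨ cong (iter f (toℕ j)) (sym (iter-+ f (suc n ∸ toℕ i) (toℕ i) r)) ⟩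
  iter f (toℕ j) (iter f (suc n ∸ toℕ i + toℕ i) r)
    ≡⟨ cong (λ m → iter f (toℕ j) (iter f m r)) (m∸n+n≡m i≤N) ⟩
  iter f (toℕ j) (iter f (suc n) r)
    ≡⟨ cong (iter f (toℕ j)) period ⟩
  iter f (toℕ j) r ∎)
  where
  open ≡.≡-Reasoning
  i≤N : toℕ i ≤ suc n
  i≤N = <⇒≤ (toℕ<n i)
  j+[N∸i]<N : toℕ j + (suc n ∸ toℕ i) < suc n
  j+[N∸i]<N = ≡.subst (toℕ j + (suc n ∸ toℕ i) <_) (m+[n∸m]≡n i≤N) (+-monoˡ-< (suc n ∸ toℕ i) (≰⇒> i≰j))

shift-singleCycle : ∀ {n} → SingleCycle (shift {n})
shift-singleCycle = singleCycle-from-root shift zero iter-shift-period (λ c → c , iter-shift-zero c)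

injective⇒surjective : ∀ {n} {f : Fin n → Fin n} → Injective _≡_ _≡_ f → ∀ c → ∃ λ k → f k ≡ c
injective⇒surjective {suc n} {f} f-inj c with any? (λ k → f k ≟ c)
... | yes hit  = hit
... | no  miss = contradiction (injective⇒≤ squeeze-injective) (<-irrefl refl)
  where
  squeeze : Fin (suc n) → Fin n
  squeeze k = punchOut {i = c} (λ eq → miss (k , sym eq))
  squeeze-injective : Injective _≡_ _≡_ squeeze
  squeeze-injective {a} {b} eq = f-inj (punchOut-injective {i = c} (λ e → miss (a , sym e)) (λ e → miss (b , sym e)) eq)

module Labelling {n : ℕ} (τ : Fin (suc n) → Fin (suc n)) (τ-injective : Injective _≡_ _≡_ τ)
                 (r : Fin (suc n)) (reach : ∀ c → ∃ λ (k : Fin (suc n)) → iter τ (toℕ k) r ≡ c) where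

  label : Fin (suc n) → Fin (suc n)
  label k = iter τ (toℕ k) r

  unlabel : Fin (suc n) → Fin (suc n)
  unlabel c = proj₁ (reach c)

  label-unlabel : ∀ c → label (unlabel c) ≡ c
  label-unlabel c = proj₂ (reach c)

  unlabel-injective : Injective _≡_ _≡_ unlabel
  unlabel-injective {c} {d} eq = trans (sym (label-unlabel c)) (trans (cong label eq) (label-unlabel d))

  label-injective : Injective _≡_ _≡_ label
  label-injective {a} {b} eq with injective⇒surjective unlabel-injective a | injective⇒surjective unlabel-injective b
  ... | c , refl | d , refl = cong unlabel (trans (sym (label-unlabel c)) (trans eq (label-unlabel d)))

  labelling : Permutation′ (suc n)
  labelling = permutation label unlabel label-unlabel (λ k → label-injective (label-unlabel (label k)))

  -- τⁿ⁺¹ r is some τʲ r with j ≤ n; cancelling one τ, j = 0 is forced by injectivity of label.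
  iter-period : iter τ (suc n) r ≡ r
  iter-period with reach (iter τ (suc n) r)
  ... | zero  , eq = sym eq
  ... | suc j , eq = contradiction (label-injective (begin
    label (fromℕ n)                ≡⟨ cong (λ m → iter τ m r) (toℕ-fromℕ n) ⟩
    iter τ n r                     ≡⟨ sym (τ-injective eq) ⟩
    iter τ (toℕ j) r               ≡⟨ cong (λ m → iter τ m r) (sym (toℕ-inject₁ j)) ⟩
    label (inject₁ j)              ∎)) (fromℕ≢inject₁ {i = j})
    where open ≡.≡-Reasoning

  label-unique : ∀ (g : Fin (suc n) → Fin (suc n)) → g zero ≡ r → (∀ k → τ (g k) ≡ g (shift k)) → ∀ k → label k ≡ g k
  label-unique g g-root g-shift k = begin
    iter τ (toℕ k) r               ≡⟨ cong (iter τ (toℕ k)) (sym g-root) ⟩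
    iter τ (toℕ k) (g zero)        ≡⟨ iter-conj g g-shift (toℕ k) zero ⟩
    g (iter shift (toℕ k) zero)    ≡⟨ cong g (iter-shift-zero k) ⟩
    g k                            ∎
    where open ≡.≡-Reasoning

  label-shift : ∀ k → τ (label k) ≡ label (shift k)
  label-shift k with m≤n⇒m<n∨m≡n (≤-pred (toℕ<n k))
  ... | inj₁ k<n = cong (λ m → iter τ m r) (sym (toℕ-shift k k<n))
  ... | inj₂ k≡n = begin
    τ (label k)        ≡⟨ cong (λ m → iter τ (suc m) r) k≡n ⟩
    iter τ (suc n) r   ≡⟨ iter-period ⟩
    r                  ≡⟨ cong label (sym (shift-last k k≡n)) ⟩
    label (shift k)    ∎
    where open ≡.≡-Reasoning

module _ {n : ℕ} (f : Permutation′ n) {s s′ : Fin n → Fin n} where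

  conj-flip : (∀ b → s′ (f ⟨$⟩ʳ b) ≡ f ⟨$⟩ʳ s b) → ∀ c → s (f ⟨$⟩ˡ c) ≡ f ⟨$⟩ˡ s′ c
  conj-flip comm c = begin
    s (f ⟨$⟩ˡ c)                          ≡⟨ sym (inverseˡ f) ⟩
    f ⟨$⟩ˡ (f ⟨$⟩ʳ s (f ⟨$⟩ˡ c))          ≡⟨ cong (f ⟨$⟩ˡ_) (sym (comm (f ⟨$⟩ˡ c))) ⟩
    f ⟨$⟩ˡ s′ (f ⟨$⟩ʳ (f ⟨$⟩ˡ c))         ≡⟨ cong (λ d → f ⟨$⟩ˡ s′ d) (inverseʳ f) ⟩
    f ⟨$⟩ˡ s′ c                           ∎
    where open ≡.≡-Reasoning

module _ {n : ℕ} where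

  Iso-sym : {A B : RootedMap n} → Iso A B → Iso B A
  Iso-sym (f , f-σ , f-α , f-r) =
    flip f , conj-flip f f-σ , conj-flip f f-α , trans (cong (f ⟨$⟩ˡ_) (sym f-r)) (inverseˡ f)

  Iso-trans : {A B C : RootedMap n} → Iso A B → Iso B C → Iso A C
  Iso-trans (f , f-σ , f-α , f-r) (g , g-σ , g-α , g-r) =
    f ∘ₚ g , (λ b → trans (g-σ _) (cong (g ⟨$⟩ʳ_) (f-σ b))) , (λ b → trans (g-α _) (cong (g ⟨$⟩ʳ_) (f-α b)))
           , trans (cong (g ⟨$⟩ʳ_) f-r) g-r

  actWord-++ : ∀ (s a : Permutation′ n) (w v : List Gen) b →
               actWord s a (w ++ v) b ≡ actWord s a w (actWord s a v b)
  actWord-++ s a []         v b = refl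
  actWord-++ s a (gσ ∷ w)   v b = cong (s ⟨$⟩ʳ_) (actWord-++ s a w v b)
  actWord-++ s a (gσ⁻¹ ∷ w) v b = cong (s ⟨$⟩ˡ_) (actWord-++ s a w v b)
  actWord-++ s a (gα ∷ w)   v b = cong (a ⟨$⟩ʳ_) (actWord-++ s a w v b)

  module _ (M M′ : Map n) (f : Permutation′ n)
           (f-σ : ∀ b → σ M′ ⟨$⟩ʳ (f ⟨$⟩ʳ b) ≡ f ⟨$⟩ʳ (σ M ⟨$⟩ʳ b))
           (f-α : ∀ b → α M′ ⟨$⟩ʳ (f ⟨$⟩ʳ b) ≡ f ⟨$⟩ʳ (α M ⟨$⟩ʳ b)) where

    actWord-conj : ∀ w b → f ⟨$⟩ʳ actWord (σ M) (α M) w b ≡ actWord (σ M′) (α M′) w (f ⟨$⟩ʳ b)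
    actWord-conj []         b = refl
    actWord-conj (gσ ∷ w)   b = trans (sym (f-σ _)) (cong (σ M′ ⟨$⟩ʳ_) (actWord-conj w b))
    actWord-conj (gσ⁻¹ ∷ w) b = trans (sym (f-σ⁻¹ _)) (cong (σ M′ ⟨$⟩ˡ_) (actWord-conj w b))
      where
      f-σ⁻¹ : ∀ c → σ M′ ⟨$⟩ˡ (f ⟨$⟩ʳ c) ≡ f ⟨$⟩ʳ (σ M ⟨$⟩ˡ c)
      f-σ⁻¹ c = begin
        σ M′ ⟨$⟩ˡ (f ⟨$⟩ʳ c)                          ≡⟨ cong (λ d → σ M′ ⟨$⟩ˡ (f ⟨$⟩ʳ d)) (sym (inverseʳ (σ M))) ⟩
        σ M′ ⟨$⟩ˡ (f ⟨$⟩ʳ (σ M ⟨$⟩ʳ (σ M ⟨$⟩ˡ c)))   ≡⟨ cong (σ M′ ⟨$⟩ˡ_) (sym (f-σ _)) ⟩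
        σ M′ ⟨$⟩ˡ (σ M′ ⟨$⟩ʳ (f ⟨$⟩ʳ (σ M ⟨$⟩ˡ c)))  ≡⟨ inverseˡ (σ M′) ⟩
        f ⟨$⟩ʳ (σ M ⟨$⟩ˡ c)                           ∎
        where open ≡.≡-Reasoning
    actWord-conj (gα ∷ w)   b = trans (sym (f-α _)) (cong (α M′ ⟨$⟩ʳ_) (actWord-conj w b))

  Iso-unique : {A B : RootedMap n} (f g : Iso A B) → proj₁ f ≈ₚ proj₁ g
  Iso-unique {M , r} {M′ , _} (f , f-σ , f-α , f-r) (g , g-σ , g-α , g-r) c with transitive M r c
  ... | w , refl = begin
    f ⟨$⟩ʳ actWord (σ M) (α M) w r    ≡⟨ actWord-conj M M′ f f-σ f-α w r ⟩
    actWord _ _ w (f ⟨$⟩ʳ r)          ≡⟨ cong (actWord _ _ w) (trans f-r (sym g-r)) ⟩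
    actWord _ _ w (g ⟨$⟩ʳ r)          ≡⟨ sym (actWord-conj M M′ g g-σ g-α w r) ⟩
    g ⟨$⟩ʳ actWord (σ M) (α M) w r    ∎
    where open ≡.≡-Reasoning

module _ {n : ℕ} (J : MarkedMatching n) where

  switch : Fin n → Fin n
  switch b = if marked J b then partner J b else b

  switch-involutive : ∀ b → switch (switch b) ≡ b
  switch-involutive b with marked J b in eq
  ... | true  rewrite sym (marked-closed J b) | eq = partner-involutive J b
  ... | false rewrite eq = refl

switch-cong : ∀ {n} {I J : MarkedMatching n} → I ≈ₘ J → switch I ≗ switch J
switch-cong {I = I} (mk≈ₘ p m) b rewrite m b | p b = refl

switch-conjugate : ∀ {n} (π : Permutation′ n) (I : MarkedMatching n) b →
                   switch (conjugate π I) (π ⟨$⟩ʳ b) ≡ π ⟨$⟩ʳ switch I b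
switch-conjugate π I b rewrite inverseˡ π {b} with marked I b
... | true  = refl
... | false = refl

matchingOf : ∀ {n} (M : Map n) (S : Subset n) → EdgeClosed M S → MarkedMatching n
matchingOf M S closed = record
  { partner = α M ⟨$⟩ʳ_ ; marked = lookup S ; partner-involutive = α-invol M
  ; partner-fpf = α-fpf M ; marked-closed = closed }

module _ {n : ℕ} (M : Map n) (S : Subset n) (closed : EdgeClosed M S) where

  tour-switch : ∀ b → tour M S b ≡ σ M ⟨$⟩ʳ switch (matchingOf M S closed) b
  tour-switch b with lookup S b
  ... | true  = refl
  ... | false = refl

  σ-switch : ∀ b → σ M ⟨$⟩ʳ b ≡ tour M S (switch (matchingOf M S closed) b)
  σ-switch b = trans (cong (σ M ⟨$⟩ʳ_) (sym (switch-involutive (matchingOf M S closed) b))) (sym (tour-switch _))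

  tour-injective : Injective _≡_ _≡_ (tour M S)
  tour-injective {a} {b} eq = begin
    a                                     ≡⟨ sym (switch-involutive J a) ⟩
    switch J (switch J a)                 ≡⟨ cong (switch J) (σ-injective (trans (sym (tour-switch a)) (trans eq (tour-switch b)))) ⟩
    switch J (switch J b)                 ≡⟨ switch-involutive J b ⟩
    b                                     ∎
    where
    open ≡.≡-Reasoning
    J = matchingOf M S closed
    σ-injective : Injective _≡_ _≡_ (σ M ⟨$⟩ʳ_)
    σ-injective {c} {d} eq = trans (sym (inverseˡ (σ M))) (trans (cong (σ M ⟨$⟩ˡ_) eq) (inverseˡ (σ M)))

image : ∀ {n} → Permutation′ n → Subset n → Subset n
image f S = tabulate (λ b → lookup S (f ⟨$⟩ˡ b))

lookup-image : ∀ {n} (f : Permutation′ n) S b → lookup (image f S) (f ⟨$⟩ʳ b) ≡ lookup S b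
lookup-image f S b = trans (lookup∘tabulate (λ c → lookup S (f ⟨$⟩ˡ c)) (f ⟨$⟩ʳ b)) (cong (lookup S) (inverseˡ f))

image-cong : ∀ {n} (π ρ : Permutation′ n) (S T : Subset n) →
             flip π ≈ₚ flip ρ → (∀ b → lookup S b ≡ lookup T b) → image π S ≡ image ρ T
image-cong π ρ S T π⁻¹≈ρ⁻¹ S≗T = tabulate-cong (λ b → trans (cong (lookup S) (π⁻¹≈ρ⁻¹ b)) (S≗T _))

image-preimage : ∀ {n} (π : Permutation′ n) (S : Subset n) → image π (tabulate (lookup S ∘ (π ⟨$⟩ʳ_))) ≡ S
image-preimage π S = trans (tabulate-cong λ b → trans (lookup∘tabulate (lookup S ∘ (π ⟨$⟩ʳ_)) _) (cong (lookup S) (inverseʳ π)))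
                           (tabulate∘lookup S)

module _ {n : ℕ} (M M′ : Map n) (f : Permutation′ n)
         (f-σ : ∀ b → σ M′ ⟨$⟩ʳ (f ⟨$⟩ʳ b) ≡ f ⟨$⟩ʳ (σ M ⟨$⟩ʳ b))
         (f-α : ∀ b → α M′ ⟨$⟩ʳ (f ⟨$⟩ʳ b) ≡ f ⟨$⟩ʳ (α M ⟨$⟩ʳ b)) (S : Subset n) where

  image-edgeClosed : EdgeClosed M S → EdgeClosed M′ (image f S)
  image-edgeClosed closed b = begin
    lookup (image f S) b                            ≡⟨ cong (lookup (image f S)) (sym (inverseʳ f)) ⟩
    lookup (image f S) (f ⟨$⟩ʳ c)                   ≡⟨ lookup-image f S c ⟩
    lookup S c                                      ≡⟨ closed c ⟩
    lookup S (α M ⟨$⟩ʳ c)                           ≡⟨ sym (lookup-image f S _) ⟩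
    lookup (image f S) (f ⟨$⟩ʳ (α M ⟨$⟩ʳ c))        ≡⟨ cong (lookup (image f S)) (sym (f-α c)) ⟩
    lookup (image f S) (α M′ ⟨$⟩ʳ (f ⟨$⟩ʳ c))       ≡⟨ cong (λ d → lookup (image f S) (α M′ ⟨$⟩ʳ d)) (inverseʳ f) ⟩
    lookup (image f S) (α M′ ⟨$⟩ʳ b)                ∎
    where
    open ≡.≡-Reasoning
    c = f ⟨$⟩ˡ b

  tour-image : ∀ b → tour M′ (image f S) (f ⟨$⟩ʳ b) ≡ f ⟨$⟩ʳ tour M S b
  tour-image b rewrite lookup-image f S b with lookup S b
  ... | true  = trans (cong (σ M′ ⟨$⟩ʳ_) (f-α b)) (f-σ _)
  ... | false = f-σ b

  image-singleCycle : SingleCycle (tour M S) → SingleCycle (tour M′ (image f S))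
  image-singleCycle cycle b c with cycle (f ⟨$⟩ˡ b) (f ⟨$⟩ˡ c)
  ... | k , eq = k , (begin
    iter (tour M′ (image f S)) (toℕ k) b                   ≡⟨ cong (iter _ (toℕ k)) (sym (inverseʳ f)) ⟩
    iter (tour M′ (image f S)) (toℕ k) (f ⟨$⟩ʳ (f ⟨$⟩ˡ b)) ≡⟨ iter-conj (f ⟨$⟩ʳ_) tour-image (toℕ k) _ ⟩
    f ⟨$⟩ʳ iter (tour M S) (toℕ k) (f ⟨$⟩ˡ b)              ≡⟨ cong (f ⟨$⟩ʳ_) eq ⟩
    f ⟨$⟩ʳ (f ⟨$⟩ˡ c)                                       ≡⟨ inverseʳ f ⟩
    c                                                       ∎)
    where open ≡.≡-Reasoning

  image-quasiTree : IsQuasiTree M S → IsQuasiTree M′ (image f S)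
  image-quasiTree (closed , cycle) = image-edgeClosed closed , image-singleCycle cycle

  matchingOf-image : ∀ closed closed′ → conjugate (flip f) (matchingOf M′ (image f S) closed′) ≈ₘ matchingOf M S closed
  matchingOf-image _ _ = mk≈ₘ (λ b → trans (cong (f ⟨$⟩ˡ_) (f-α b)) (inverseˡ f)) (lookup-image f S)

module _ {n : ℕ} (J : MarkedMatching (suc n)) where

  σOf : Permutation′ (suc n)
  σOf = permutation (shift ∘ switch J) (switch J ∘ unshift)
                    (λ k → trans (cong shift (switch-involutive J (unshift k))) (shift-unshift k))
                    (λ k → trans (cong (switch J) (unshift-shift (switch J k))) (switch-involutive J k))

  αOf : Permutation′ (suc n)
  αOf = permutation (partner J) (partner J) (partner-involutive J) (partner-involutive J)

  σOf-switch : ∀ b → σOf ⟨$⟩ʳ switch J b ≡ shift b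
  σOf-switch b = cong shift (switch-involutive J b)

  private
    switch-word : ∀ (s : Permutation′ (suc n)) b → actWord s αOf (if marked J b then gα ∷ [] else []) b ≡ switch J b
    switch-word s b with marked J b
    ... | true  = refl
    ... | false = refl

    iter-shift-word : ∀ k b → ∃ λ w → actWord σOf αOf w b ≡ iter shift k b
    iter-shift-word zero    b = [] , refl
    iter-shift-word (suc k) b =
      let (w , e) = iter-shift-word k b
          v = gσ ∷ (if marked J (iter shift k b) then gα ∷ [] else [])
      in v ++ w , trans (actWord-++ σOf αOf v w b)
                        (trans (cong (actWord σOf αOf v) e)
                               (trans (cong (σOf ⟨$⟩ʳ_) (switch-word σOf _)) (σOf-switch _)))

  mapOf : Map (suc n)
  mapOf = record
    { σ = σOf ; α = αOf ; α-invol = partner-involutive J ; α-fpf = partner-fpf J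
    ; transitive = λ b c → let (k , e) = shift-singleCycle b c ; (w , e′) = iter-shift-word (toℕ k) b
                           in w , trans e′ e }

  subsetOf : Subset (suc n)
  subsetOf = tabulate (marked J)

  subsetOf-edgeClosed : EdgeClosed mapOf subsetOf
  subsetOf-edgeClosed b =
    trans (lookup∘tabulate (marked J) b) (trans (marked-closed J b) (sym (lookup∘tabulate (marked J) _)))

  tour-mapOf : ∀ b → tour mapOf subsetOf b ≡ shift b
  tour-mapOf b = trans (tour-switch mapOf subsetOf subsetOf-edgeClosed b)
                       (trans (cong (λ m → σOf ⟨$⟩ʳ (if m then partner J b else b)) (lookup∘tabulate (marked J) b))
                              (σOf-switch b))

  subsetOf-quasiTree : IsQuasiTree mapOf subsetOf
  subsetOf-quasiTree = subsetOf-edgeClosed , λ b c →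
    let (k , e) = shift-singleCycle b c in k , trans (iter-cong tour-mapOf (toℕ k) b) e

subsetOf-cong : ∀ {n} {J J′ : MarkedMatching (suc n)} → J ≈ₘ J′ → ∀ b → lookup (subsetOf J) b ≡ lookup (subsetOf J′) b
subsetOf-cong {J = J} {J′} J≈J′ b =
  trans (lookup∘tabulate (marked J) b) (trans (_≈ₘ_.marked-≗ J≈J′ b) (sym (lookup∘tabulate (marked J′) b)))

mapOf-cong : ∀ {n} {J J′ : MarkedMatching (suc n)} → J ≈ₘ J′ → Iso (mapOf J , zero) (mapOf J′ , zero)
mapOf-cong J≈J′ = P.id , (λ b → cong shift (sym (switch-cong J≈J′ b))) , (λ b → sym (_≈ₘ_.partner-≗ J≈J′ b)) , refl

module Canonical {n : ℕ} (M : Map (suc n)) (r : Fin (suc n)) (S : Subset (suc n)) (quasiTree : IsQuasiTree M S) where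

  open Labelling (tour M S) (tour-injective M S (proj₁ quasiTree)) r (proj₂ quasiTree r) public

  canonical : MarkedMatching (suc n)
  canonical = conjugate (flip labelling) (matchingOf M S (proj₁ quasiTree))

  canonical-iso : Iso (mapOf canonical , zero) (M , r)
  canonical-iso = labelling , labelling-σ , (λ b → sym (inverseʳ labelling)) , refl
    where
    I = matchingOf M S (proj₁ quasiTree)
    labelling-σ : ∀ b → σ M ⟨$⟩ʳ label b ≡ label (shift (switch canonical b))
    labelling-σ b = begin
      σ M ⟨$⟩ʳ label b
        ≡⟨ σ-switch M S (proj₁ quasiTree) (label b) ⟩
      tour M S (switch I (label b))
        ≡⟨ cong (tour M S) (sym (inverseʳ labelling)) ⟩
      tour M S (label (unlabel (switch I (label b))))
        ≡⟨ cong (tour M S ∘ label) (sym (switch-conjugate (flip labelling) I (label b))) ⟩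
      tour M S (label (switch canonical (unlabel (label b))))
        ≡⟨ cong (λ c → tour M S (label (switch canonical c))) (inverseˡ labelling) ⟩
      tour M S (label (switch canonical b))
        ≡⟨ label-shift _ ⟩
      label (shift (switch canonical b)) ∎
      where open ≡.≡-Reasoning

module QuasiTreeBijection {n : ℕ} (L : List (RootedMap (suc n))) (rep : IsRepSystem L) where

  private
    Rep : Fin (length L) → RootedMap (suc n)
    Rep = List.lookup L

  QuasiTree : Fin (length L) × Subset (suc n) → Set
  QuasiTree (i , S) = IsQuasiTree (proj₁ (Rep i)) S

  representative-unique : ∀ {A} i j (f : Iso A (Rep i)) (g : Iso A (Rep j)) → i ≡ j × proj₁ f ≈ₚ proj₁ g
  representative-unique {A} i j f g with proj₂ rep i j (Iso-trans {A = Rep i} {A} {Rep j} (Iso-sym {A = A} {Rep i} f) g)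
  ... | refl = refl , Iso-unique {A = A} {Rep i} f g

  classOf : MarkedMatching (suc n) → Fin (length L)
  classOf J = proj₁ (proj₁ rep (mapOf J , zero))

  classIso : ∀ J → Iso (mapOf J , zero) (Rep (classOf J))
  classIso J = proj₂ (proj₁ rep (mapOf J , zero))

  toMatching : Σ _ QuasiTree → MarkedMatching (suc n)
  toMatching ((i , S) , q) = Canonical.canonical (proj₁ (Rep i)) (proj₂ (Rep i)) S q

  toQuasiTree : MarkedMatching (suc n) → Σ _ QuasiTree
  toQuasiTree J = (classOf J , image f (subsetOf J))
          , image-quasiTree (mapOf J) (proj₁ (Rep (classOf J))) f f-σ f-α (subsetOf J) (subsetOf-quasiTree J)
    where
    f = proj₁ (classIso J)
    f-σ = proj₁ (proj₂ (classIso J))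
    f-α = proj₁ (proj₂ (proj₂ (classIso J)))

  toMatching-cong : ∀ {x y} → proj₁ x ≡ proj₁ y → toMatching x ≈ₘ toMatching y
  toMatching-cong {(i , S) , q} {_ , q′} refl =
    conjugate-cong (flip (C.labelling q)) (flip (C.labelling q′))
                   {matchingOf M S (proj₁ q)} {matchingOf M S (proj₁ q′)}
                   (inverse-cong (C.labelling q) (C.labelling q′) (λ _ → refl)) (mk≈ₘ (λ _ → refl) (λ _ → refl))
    where
    M = proj₁ (Rep i)
    module C q = Canonical M (proj₂ (Rep i)) S q

  toQuasiTree-cong : ∀ {J J′} → J ≈ₘ J′ → proj₁ (toQuasiTree J) ≡ proj₁ (toQuasiTree J′)
  toQuasiTree-cong {J} {J′} J≈J′
    with representative-unique {A = mapOf J , zero} (classOf J) (classOf J′) (classIso J)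
           (Iso-trans {A = mapOf J , zero} {mapOf J′ , zero} {Rep (classOf J′)} (mapOf-cong J≈J′) (classIso J′))
  ... | i≡i′ , f≈f′ = cong₂ _,_ i≡i′
    (image-cong f f′ (subsetOf J) (subsetOf J′) (inverse-cong f f′ f≈f′) (subsetOf-cong J≈J′))
    where
    f = proj₁ (classIso J)
    f′ = proj₁ (classIso J′)

  toMatching-toQuasiTree : ∀ J → toMatching (toQuasiTree J) ≈ₘ J
  toMatching-toQuasiTree J =
    ≈ₘ-trans (conjugate-cong (flip C.labelling) (flip f) {matchingOf M S′ closed′} {matchingOf M S′ closed′}
                             (inverse-cong C.labelling f labelling≈f) ≈ₘ-refl)
    (≈ₘ-trans (matchingOf-image (mapOf J) M f f-σ f-α (subsetOf J) (subsetOf-edgeClosed J) closed′)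
              (mk≈ₘ (λ _ → refl) (lookup∘tabulate (marked J))))
    where
    M = proj₁ (Rep (classOf J))
    f = proj₁ (classIso J)
    f-σ = proj₁ (proj₂ (classIso J))
    f-α = proj₁ (proj₂ (proj₂ (classIso J)))
    S′ = image f (subsetOf J)
    quasiTree′ = proj₂ (toQuasiTree J)
    closed′ = proj₁ quasiTree′
    module C = Canonical M (proj₂ (Rep (classOf J))) S′ quasiTree′
    labelling≈f : C.labelling ≈ₚ f
    labelling≈f = C.label-unique (f ⟨$⟩ʳ_) (proj₂ (proj₂ (proj₂ (classIso J)))) λ k →
      trans (tour-image (mapOf J) M f f-σ f-α (subsetOf J) k) (cong (f ⟨$⟩ʳ_) (tour-mapOf J k))

  toQuasiTree-toMatching : ∀ x → proj₁ (toQuasiTree (toMatching x)) ≡ proj₁ x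
  toQuasiTree-toMatching ((i , S) , q) = cong₂ _,_ (proj₁ landing) (begin
    image f (subsetOf C.canonical)
      ≡⟨ image-cong f C.labelling (subsetOf C.canonical) (subsetOf C.canonical)
                    (inverse-cong f C.labelling (proj₂ landing)) (λ _ → refl) ⟩
    image C.labelling (subsetOf C.canonical)
      ≡⟨ image-preimage C.labelling S ⟩
    S ∎)
    where
    open ≡.≡-Reasoning
    module C = Canonical (proj₁ (Rep i)) (proj₂ (Rep i)) S q
    f = proj₁ (classIso C.canonical)
    landing = representative-unique {A = mapOf C.canonical , zero} (classOf C.canonical) i
                                    (classIso C.canonical) C.canonical-iso

  quasiTrees≅markedMatchings : Inverse (Sub QuasiTree) (MarkedMatchingₛ (suc n))
  quasiTrees≅markedMatchings =
    mkInverse toMatching toQuasiTree (λ {x} {y} → toMatching-cong {x} {y}) (λ {J} {J′} → toQuasiTree-cong {J} {J′})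
              toMatching-toQuasiTree toQuasiTree-toMatching

markedMatchings-double : ∀ k → markedMatchings (2 * k) * k ! ≡ (2 * k) !
markedMatchings-double zero    = refl
markedMatchings-double (suc k) = begin
  markedMatchings (2 * suc k) * suc k !
    ≡⟨ cong (λ m → markedMatchings m * suc k !) (*-suc 2 k) ⟩
  suc (2 * k) * (2 * markedMatchings (2 * k)) * (suc k * k !)
    ≡⟨ regroup k (markedMatchings (2 * k)) (k !) ⟩
  (2 + 2 * k) * (suc (2 * k) * (markedMatchings (2 * k) * k !))
    ≡⟨ cong (λ m → (2 + 2 * k) * (suc (2 * k) * m)) (markedMatchings-double k) ⟩
  (2 + 2 * k) !
    ≡⟨ cong _! (sym (*-suc 2 k)) ⟩
  (2 * suc k) ! ∎
  where
  open ≡.≡-Reasoning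
  regroup : ∀ k c f → suc (2 * k) * (2 * c) * (suc k * f) ≡ (2 + 2 * k) * (suc (2 * k) * (c * f))
  regroup = solve-∀

quasiTree-count : ∀ {n} (L : List (RootedMap (suc n))) → IsRepSystem L →
                  sum (map (λ M● → ς (proj₁ M●)) L) ≡ markedMatchings (suc n)
quasiTree-count {n} L rep = size-unique
  (size-sum (λ M● → IsQuasiTree (proj₁ M●)) (λ M● → ς (proj₁ M●))
               (λ M● → size-filter-all-subsets (suc n) (isQuasiTree? (proj₁ M●))) L)
  (size-resp-Inverse quasiTrees≅markedMatchings (size-MarkedMatching (suc n)))
  where open QuasiTreeBijection L rep

corollary2 : ∀ (m : ℕ) → m ≥ 1 → (L : List (RootedMap (2 * m))) → IsRepSystem L
    → sum (map (λ M● → ς (proj₁ M●)) L) ≡ _/_ ((2 * m) !) (m !) {{m !≢0}}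
corollary2 (suc m) _ L rep = begin
  sum (map (λ M● → ς (proj₁ M●)) L)                     ≡⟨ quasiTree-count L rep ⟩
  markedMatchings (2 * suc m)                           ≡⟨ sym (m*n/n≡m _ (suc m !) {{suc m !≢0}}) ⟩
  _/_ (markedMatchings (2 * suc m) * suc m !) (suc m !) {{suc m !≢0}}
                                                        ≡⟨ cong (λ k → _/_ k (suc m !) {{suc m !≢0}}) (markedMatchings-double (suc m)) ⟩
  _/_ ((2 * suc m) !) (suc m !) {{suc m !≢0}}           ∎
  where open ≡.≡-Reasoning
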